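{- Let $D$ be a strongly connected orientation of a $3$-edge-connected graph $G$ and let $C$ be a circuit of $D$. Then $C$ contains an arc $a$ such that $D-a$ is strongly connected.
   Context: Graphs are finite and undirected; parallel edges are allowed. $G$ is $3$-edge-connected if at least $3$ edges leave every nonempty proper vertex subset. An orientation of $G$ replaces each edge $uv$ by exactly one of the arcs $uv$ or $vu$. A digraph is strongly connected if for every nonempty proper vertex subset $X$ some arc leaves $X$. A cycle is a connected graph in which every vertex has degree $2$; a circuit of $D$ is a subdigraph of $D$ that is a strongly connected orientation of a cycle. -}

module Defs where

open import Data.Nat using (ℕ; zero; suc; _+_; _≥_)
open import Data.Fin using (Fin; zero; suc)
open import Data.Fin.Properties using (_≟_)
open import Data.Bool using (Bool; true; false; if_then_else_; _∧_; _xor_; not; T)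
open import Data.Product using (Σ; ∃; _×_; _,_)
open import Relation.Nullary.Decidable using (⌊_⌋)
open import Relation.Binary.PropositionalEquality using (_≡_; _≢_)

-- A finite digraph (parallel arcs allowed): vertices Fin n, arcs Fin m,
-- each arc a goes from tail a to head a.  Its underlying (multi)graph has
-- the same edges, with endpoints tail a, head a; so D is an orientation of
-- its underlying graph.
record Digraph : Set where
  field
    n    : ℕ
    m    : ℕ
    tail : Fin m → Fin n
    head : Fin m → Fin n
open Digraph public

count : ∀ {k} → (Fin k → Bool) → ℕ
count {zero}  f = 0
count {suc k} f = (if f zero then 1 else 0) + count (λ i → f (suc i))

VSet : Digraph → Set
VSet D = Fin (n D) → Bool

ASet : Digraph → Set
ASet D = Fin (m D) → Bool

NonemptyProperSubsetOf : (D : Digraph) → VSet D → VSet D → Set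
NonemptyProperSubsetOf D V X =
  (∀ v → T (X v) → T (V v)) ×
  (∃ λ x → T (X x)) ×
  (∃ λ y → T (V y ∧ not (X y)))

allV : (D : Digraph) → VSet D
allV D _ = true

crosses : (D : Digraph) → VSet D → Fin (m D) → Bool
crosses D X a = X (tail D a) xor X (head D a)

leaves : (D : Digraph) → VSet D → Fin (m D) → Bool
leaves D X a = X (tail D a) ∧ not (X (head D a))

ThreeEdgeConnected : Digraph → Set
ThreeEdgeConnected D =
  ∀ X → NonemptyProperSubsetOf D (allV D) X → count (crosses D X) ≥ 3

StronglyConnectedOn : (D : Digraph) → VSet D → ASet D → Set
StronglyConnectedOn D V A =
  ∀ X → NonemptyProperSubsetOf D V X → ∃ λ a → T (A a ∧ leaves D X a)

StronglyConnected : (D : Digraph) → ASet D → Set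
StronglyConnected D A = StronglyConnectedOn D (allV D) A

allA : (D : Digraph) → ASet D
allA D _ = true

minusArc : (D : Digraph) → Fin (m D) → ASet D
minusArc D a b = not ⌊ a ≟ b ⌋

Loopless : Digraph → Set
Loopless D = ∀ a → tail D a ≢ head D a

IsSubdigraph : (D : Digraph) → VSet D → ASet D → Set
IsSubdigraph D V A = ∀ a → T (A a) → T (V (tail D a) ∧ V (head D a))

degreeIn : (D : Digraph) → ASet D → Fin (n D) → ℕ
degreeIn D A v =
  count (λ a → A a ∧ ⌊ tail D a ≟ v ⌋) + count (λ a → A a ∧ ⌊ head D a ≟ v ⌋)

ConnectedOn : (D : Digraph) → VSet D → ASet D → Set
ConnectedOn D V A =
  (∃ λ v → T (V v)) ×
  (∀ X → NonemptyProperSubsetOf D V X → ∃ λ a → T (A a ∧ crosses D X a))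

IsCycle : (D : Digraph) → VSet D → ASet D → Set
IsCycle D V A = ConnectedOn D V A × (∀ v → T (V v) → degreeIn D A v ≡ 2)

IsCircuit : (D : Digraph) → VSet D → ASet D → Set
IsCircuit D V A = IsSubdigraph D V A × IsCycle D V A × StronglyConnectedOn D V A

-- If no arc of C is deletable, every arc f of C is the only arc leaving some
-- vertex set; take such a set Y_f of minimum size.  Start from U = Y_g for an
-- arc g of C and repeatedly add Y_f for an arc f of C entering U.  Throughout,
-- g is the only arc leaving U, and no set Y whose only leaving arc f enters U
-- (with head f outside Y) covers the complement of U: otherwise minimality
-- makes some piece of U disjoint from Y, left only by its own arc and entered
-- only by f, a 2-edge cut.  This forces each new piece to avoid both ends of g
-- and hence to be disjoint from U, so U grows forever in a finite vertex set.
module Submission where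

open import Defs
open import Data.Bool using (Bool; true; false; T; not; _∧_; _∨_; _xor_; if_then_else_)
open import Data.Bool.Properties using (T-∧; T-∨)
open import Data.Empty using (⊥; ⊥-elim)
open import Data.Fin using (Fin; zero; suc)
open import Data.Fin.Properties using (_≟_; any?; all?; 0≢1+n; suc-injective)
open import Data.Fin.Subset.Properties using (anySubset?)
open import Data.Nat using (ℕ; zero; suc; _+_; _≤_; _<_; z≤n; s≤s; _<?_)
open import Data.Nat.Induction using (<-wellFounded)
open import Data.Nat.Properties
  using (≤-refl; ≤-trans; ≤-reflexive; +-mono-≤; +-monoˡ-≤; +-mono-<-≤; +-mono-≤-<;
         +-suc; +-identityʳ; m≤n+m; <⇒≱; ≮⇒≥; +-commutativeSemigroup;
         module ≤-Reasoning)
open import Algebra.Properties.CommutativeSemigroup +-commutativeSemigroup using (interchange)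
open import Data.Product using (∃; ∄; _×_; _,_; proj₁; proj₂)
open import Data.Sum using (_⊎_; inj₁; inj₂; [_,_]′)
import Data.Sum as Sum
open import Data.Vec using (lookup; tabulate)
open import Data.Vec.Properties using (lookup∘tabulate)
open import Function using (_∘_; Equivalence)
open import Induction.WellFounded using (Acc; acc)
open import Relation.Nullary using (¬_; Dec; yes; no)
open import Relation.Nullary.Decidable
  using (⌊_⌋; T?; ¬?; _×-dec_; _→-dec_; map′; decidable-stable;
         fromWitness; toWitness; fromWitnessFalse)
open import Relation.Binary.PropositionalEquality
  using (_≡_; _≢_; refl; sym; trans; cong; cong₂; subst; _≗_)

open Equivalence using (to; from)

T-not⁺ : ∀ {x} → ¬ T x → T (not x)
T-not⁺ {true}  ¬x = ¬x _
T-not⁺ {false} _  = _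

T-not⁻ : ∀ {x} → T (not x) → ¬ T x
T-not⁻ {true} ()

T-∧⁻ : ∀ x {y} → T (x ∧ y) → T x × T y
T-∧⁻ x = to (T-∧ {x})

T-∧-not⁺ : ∀ {x y} → T x → ¬ T y → T (x ∧ not y)
T-∧-not⁺ {true} _ ¬y = T-not⁺ ¬y

T-∧-not⁻ : ∀ x {y} → T (x ∧ not y) → T x × ¬ T y
T-∧-not⁻ true t = _ , T-not⁻ t

T-xor⁻ : ∀ {x y} → T (x xor y) → (T x × ¬ T y) ⊎ (T y × ¬ T x)
T-xor⁻ {true}  {false} _ = inj₁ (_ , λ ())
T-xor⁻ {false} {true}  _ = inj₂ (_ , λ ())

indicator : Bool → ℕ
indicator b = if b then 1 else 0

indicator≤1 : ∀ x → indicator x ≤ 1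
indicator≤1 false = z≤n
indicator≤1 true  = ≤-refl

indicator-mono : ∀ {x y} → (T x → T y) → indicator x ≤ indicator y
indicator-mono {false}         _   = z≤n
indicator-mono {true} {true}   _   = ≤-refl
indicator-mono {true} {false}  x⇒y = ⊥-elim (x⇒y _)

indicator-< : ∀ {x y} → T y → ¬ T x → indicator x < indicator y
indicator-< {true}          _ ¬x = ⊥-elim (¬x _)
indicator-< {false} {true}  _ _  = s≤s z≤n

indicator-∨ : ∀ x y → indicator (x ∨ y) ≤ indicator x + indicator y
indicator-∨ false _ = ≤-refl
indicator-∨ true  _ = s≤s z≤n

count≤ : ∀ {k} (p : Fin k → Bool) → count p ≤ k
count≤ {zero}  p = z≤n
count≤ {suc k} p = +-mono-≤ (indicator≤1 (p zero)) (count≤ (p ∘ suc))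

count-cong : ∀ {k} {p q : Fin k → Bool} → p ≗ q → count p ≡ count q
count-cong {zero}  _   = refl
count-cong {suc k} p≗q = cong₂ _+_ (cong indicator (p≗q zero)) (count-cong (p≗q ∘ suc))

count-mono : ∀ {k} {p q : Fin k → Bool} →
  (∀ i → T (p i) → T (q i)) → count p ≤ count q
count-mono {zero}  _   = z≤n
count-mono {suc k} p⇒q = +-mono-≤ (indicator-mono (p⇒q zero)) (count-mono (p⇒q ∘ suc))

count-< : ∀ {k} {p q : Fin k → Bool} → (∀ i → T (p i) → T (q i)) →
  ∀ j → T (q j) → ¬ T (p j) → count p < count q
count-< {suc k} p⇒q zero    qj ¬pj =
  +-mono-<-≤ (indicator-< qj ¬pj) (count-mono (p⇒q ∘ suc))
count-< {suc k} p⇒q (suc j) qj ¬pj =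
  +-mono-≤-< (indicator-mono (p⇒q zero)) (count-< (p⇒q ∘ suc) j qj ¬pj)

count-∨ : ∀ {k} (p q : Fin k → Bool) → count (λ i → p i ∨ q i) ≤ count p + count q
count-∨ {zero}  _ _ = z≤n
count-∨ {suc k} p q = begin
  indicator (p zero ∨ q zero) + count (λ i → p (suc i) ∨ q (suc i))
    ≤⟨ +-mono-≤ (indicator-∨ (p zero) (q zero)) (count-∨ (p ∘ suc) (q ∘ suc)) ⟩
  (indicator (p zero) + indicator (q zero)) + (count (p ∘ suc) + count (q ∘ suc))
    ≡⟨ interchange (indicator (p zero)) _ _ _ ⟩
  count p + count q ∎
  where open ≤-Reasoning

count-none : ∀ {k} {p : Fin k → Bool} → (∀ i → ¬ T (p i)) → count p ≡ 0
count-none {zero}      _    = refl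
count-none {suc k} {p} none with p zero | none zero
... | false | _   = count-none (none ∘ suc)
... | true  | ¬p₀ = ⊥-elim (¬p₀ _)

count-≤1 : ∀ {k} {p : Fin k → Bool} (a : Fin k) →
  (∀ i → T (p i) → i ≡ a) → count p ≤ 1
count-≤1 {suc k} {p} zero only =
  +-mono-≤ (indicator≤1 (p zero))
    (≤-reflexive (count-none (λ i pi → 0≢1+n (sym (only (suc i) pi)))))
count-≤1 {suc k} {p} (suc a) only with p zero | only zero
... | false | _     = count-≤1 a (λ i pi → suc-injective (only (suc i) pi))
... | true  | only₀ = ⊥-elim (0≢1+n (only₀ _))

count-≤2 : ∀ {k} {p : Fin k → Bool} (a b : Fin k) →
  (∀ i → T (p i) → i ≡ a ⊎ i ≡ b) → count p ≤ 2
count-≤2 {p = p} a b a-or-b = begin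
  count p
    ≤⟨ count-mono (λ i → from (T-∨ {⌊ i ≟ a ⌋}) ∘ Sum.map fromWitness fromWitness ∘ a-or-b i) ⟩
  count (λ i → ⌊ i ≟ a ⌋ ∨ ⌊ i ≟ b ⌋)
    ≤⟨ count-∨ (λ i → ⌊ i ≟ a ⌋) (λ i → ⌊ i ≟ b ⌋) ⟩
  count (λ i → ⌊ i ≟ a ⌋) + count (λ i → ⌊ i ≟ b ⌋)
    ≤⟨ +-mono-≤ (count-≤1 a (λ _ → toWitness)) (count-≤1 b (λ _ → toWitness)) ⟩
  2 ∎
  where open ≤-Reasoning

count-∃ : ∀ {k} (p : Fin k → Bool) → count p ≡ 0 ⊎ ∃ λ i → T (p i)
count-∃ {zero}  p = inj₁ refl
count-∃ {suc k} p with p zero in p₀ | count-∃ (p ∘ suc)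
... | true  | _             = inj₂ (zero , subst T (sym p₀) _)
... | false | inj₁ none     = inj₁ none
... | false | inj₂ (i , pi) = inj₂ (suc i , pi)

anySubset′? : ∀ {k} {P : (Fin k → Bool) → Set} → (∀ {X Y} → X ≗ Y → P X → P Y) →
  (∀ X → Dec (P X)) → Dec (∃ P)
anySubset′? resp P? =
  map′ (λ (s , Ps) → lookup s , Ps)
       (λ (X , PX) → tabulate X , resp (λ i → sym (lookup∘tabulate X i)) PX)
       (anySubset? (P? ∘ lookup))

no-ascending-chain : ∀ {S : Set} (μ : S → ℕ) {b} → (∀ s → μ s ≤ b) →
  (∀ s → ∃ λ s′ → μ s < μ s′) → ¬ S
no-ascending-chain μ {b} bounded ascend s = exhausted (suc b) s (m≤n+m (suc b) (μ s))
  where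
  exhausted : ∀ k s → b < μ s + k → ⊥
  exhausted zero    s b<μs = <⇒≱ (subst (b <_) (+-identityʳ (μ s)) b<μs) (bounded s)
  exhausted (suc k) s b<μs+1+k with ascend s
  ... | s′ , μs<μs′ = exhausted k s′ (begin-strict
    b                <⟨ b<μs+1+k ⟩
    μ s + suc k      ≡⟨ +-suc (μ s) k ⟩
    suc (μ s) + k    ≤⟨ +-monoˡ-≤ k μs<μs′ ⟩
    μ s′ + k         ∎)
    where open ≤-Reasoning

module CircuitArcs (D : Digraph) where

  Vertex : Set
  Vertex = Fin (n D)

  Arc : Set
  Arc = Fin (m D)

  infix  4 _∈_ _∉_ _⊆_
  infixr 6 _∪_
  infixr 7 _∩_ _∖_

  _∈_ : Vertex → VSet D → Set
  v ∈ X = T (X v)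

  _∉_ : Vertex → VSet D → Set
  v ∉ X = ¬ v ∈ X

  _⊆_ : VSet D → VSet D → Set
  X ⊆ Y = ∀ v → v ∈ X → v ∈ Y

  -- Opaque, so that the sets in  v ∈ X ∪ Y  can be inferred by unification.
  opaque
    ∅ : VSet D
    ∅ _ = false

    _∪_ : VSet D → VSet D → VSet D
    (X ∪ Y) v = X v ∨ Y v

    _∩_ : VSet D → VSet D → VSet D
    (X ∩ Y) v = X v ∧ Y v

    _∖_ : VSet D → VSet D → VSet D
    (X ∖ Y) v = X v ∧ not (Y v)

  opaque
    unfolding ∅ _∪_ _∩_ _∖_

    ∉∅ : ∀ {v} → v ∉ ∅
    ∉∅ ()

    ∅-∪ : ∀ X → ∅ ∪ X ≗ X
    ∅-∪ X v = refl

    ∈-∪⁺ˡ : ∀ {X Y v} → v ∈ X → v ∈ X ∪ Y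
    ∈-∪⁺ˡ v∈X = from T-∨ (inj₁ v∈X)

    ∈-∪⁺ʳ : ∀ {X Y v} → v ∈ Y → v ∈ X ∪ Y
    ∈-∪⁺ʳ {X} v∈Y = from (T-∨ {X _}) (inj₂ v∈Y)

    ∈-∪⁻ : ∀ {X Y v} → v ∈ X ∪ Y → v ∈ X ⊎ v ∈ Y
    ∈-∪⁻ {X} = to (T-∨ {X _})

    ∈-∩⁺ : ∀ {X Y v} → v ∈ X → v ∈ Y → v ∈ X ∩ Y
    ∈-∩⁺ v∈X v∈Y = from T-∧ (v∈X , v∈Y)

    ∈-∩⁻ : ∀ {X Y v} → v ∈ X ∩ Y → v ∈ X × v ∈ Y
    ∈-∩⁻ {X} = T-∧⁻ (X _)

    ∈-∖⁺ : ∀ {X Y v} → v ∈ X → v ∉ Y → v ∈ X ∖ Y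
    ∈-∖⁺ = T-∧-not⁺

    ∈-∖⁻ : ∀ {X Y v} → v ∈ X ∖ Y → v ∈ X × v ∉ Y
    ∈-∖⁻ {X} = T-∧-not⁻ (X _)

  Leaves : VSet D → Arc → Set
  Leaves X e = tail D e ∈ X × head D e ∉ X

  Enters : VSet D → Arc → Set
  Enters X e = head D e ∈ X × tail D e ∉ X

  OnlyLeaving : VSet D → Arc → Set
  OnlyLeaving X g = ∀ e → Leaves X e → e ≡ g

  OnlyEntering : VSet D → Arc → Set
  OnlyEntering X g = ∀ e → Enters X e → e ≡ g

  UniqueLeaving : VSet D → Arc → Set
  UniqueLeaving X g = OnlyLeaving X g × Leaves X g

  leaves⁻ : ∀ X e → T (leaves D X e) → Leaves X e
  leaves⁻ X e = T-∧-not⁻ (X (tail D e))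

  leaves⁺ : ∀ X e → Leaves X e → T (leaves D X e)
  leaves⁺ X e (t , h) = T-∧-not⁺ t h

  leaves-∪ : ∀ {X Y e} → Leaves (X ∪ Y) e → Leaves X e ⊎ Leaves Y e
  leaves-∪ (t , h) = Sum.map (_, h ∘ ∈-∪⁺ˡ) (_, h ∘ ∈-∪⁺ʳ) (∈-∪⁻ t)

  leaves-∩ : ∀ {X Y e} → Leaves (X ∩ Y) e → Leaves X e ⊎ Leaves Y e
  leaves-∩ {X} {Y} {e} (t , h) with T? (X (head D e))
  ... | no  h∉X = inj₁ (proj₁ (∈-∩⁻ t) , h∉X)
  ... | yes h∈X = inj₂ (proj₂ (∈-∩⁻ t) , h ∘ ∈-∩⁺ h∈X)

  leaves? : ∀ X e → Dec (Leaves X e)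
  leaves? X e = T? (X (tail D e)) ×-dec ¬? (T? (X (head D e)))

  uniqueLeaving? : ∀ X g → Dec (UniqueLeaving X g)
  uniqueLeaving? X g = all? (λ e → leaves? X e →-dec e ≟ g) ×-dec leaves? X g

  leaves-resp : ∀ {X Y e} → X ≗ Y → Leaves X e → Leaves Y e
  leaves-resp {e = e} X≗Y (t , h) =
    subst T (X≗Y (tail D e)) t , h ∘ subst T (sym (X≗Y (head D e)))

  uniqueLeaving-resp : ∀ {X Y g} → X ≗ Y → UniqueLeaving X g → UniqueLeaving Y g
  uniqueLeaving-resp X≗Y (only , g-leaves) =
    (λ e → only e ∘ leaves-resp (sym ∘ X≗Y)) , leaves-resp X≗Y g-leaves

  uniqueLeaving-exists? : ∀ g → Dec (∃ λ X → UniqueLeaving X g)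
  uniqueLeaving-exists? g = anySubset′? uniqueLeaving-resp (λ X → uniqueLeaving? X g)

  cycle-has-arc : ∀ {V A} → IsCycle D V A → ∃ λ g → T (A g)
  cycle-has-arc {V} {A} (((v , v∈V) , _) , degree)
    with count-∃ (λ a → A a ∧ ⌊ tail D a ≟ v ⌋) | count-∃ (λ a → A a ∧ ⌊ head D a ≟ v ⌋)
  ... | inj₂ (g , t) | _             = g , proj₁ (T-∧⁻ (A g) t)
  ... | inj₁ _       | inj₂ (g , t) = g , proj₁ (T-∧⁻ (A g) t)
  ... | inj₁ none₁   | inj₁ none₂   =
    ⊥-elim (0≢2 (trans (cong₂ _+_ (sym none₁) (sym none₂)) (degree v v∈V)))
    where
    0≢2 : 0 ≢ 2
    0≢2 ()

  subdigraph-ends : ∀ {V A a} → IsSubdigraph D V A → T (A a) →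
    tail D a ∈ V × head D a ∈ V
  subdigraph-ends {V} {a = a} sub = T-∧⁻ (V (tail D a)) ∘ sub a

  enters-separating : ∀ {V A U} → IsSubdigraph D V A → StronglyConnectedOn D V A →
    ∀ {v w} → v ∈ V → v ∉ U → w ∈ V → w ∈ U → ∃ λ f → T (A f) × Enters U f
  enters-separating {V} {A} {U} sub scC {v} {w} v∈V v∉U w∈V w∈U
    with scC (V ∖ U) ((λ _ → proj₁ ∘ ∈-∖⁻) ,
                      (v , ∈-∖⁺ v∈V v∉U) ,
                      (w , T-∧-not⁺ w∈V λ w∈V∖U → proj₂ (∈-∖⁻ w∈V∖U) w∈U))
  ... | f , f∈A∩out with T-∧⁻ (A f) f∈A∩out
  ...   | f∈A , f-out with leaves⁻ (V ∖ U) f f-out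
  ...     | tf∈V∖U , hf∉V∖U = f , f∈A , hf∈U , proj₂ (∈-∖⁻ tf∈V∖U)
    where
    hf∈U : head D f ∈ U
    hf∈U = decidable-stable (T? (U (head D f))) λ hf∉U →
      hf∉V∖U (∈-∖⁺ (proj₂ (subdigraph-ends {V} sub f∈A)) hf∉U)

  no-two-arc-cut : ThreeEdgeConnected D → ∀ X {v w a b} → v ∈ X → w ∉ X →
    OnlyLeaving X a → OnlyEntering X b → ⊥
  no-two-arc-cut tec X {v} {w} {a} {b} v∈X w∉X only-a only-b =
    3≰2 (≤-trans (tec X ((λ _ _ → _) , (v , v∈X) , (w , T-not⁺ w∉X)))
                 (count-≤2 a b crossing))
    where
    3≰2 : ¬ 3 ≤ 2
    3≰2 (s≤s (s≤s ()))
    crossing : ∀ e → T (crosses D X e) → e ≡ a ⊎ e ≡ b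
    crossing e = Sum.map (only-a e) (only-b e) ∘ T-xor⁻ {X (tail D e)}

  module StrongConnectivity (sc : StronglyConnected D (allA D)) where

    leaving-arc : ∀ X {v w} → v ∈ X → w ∉ X → ∃ λ e → Leaves X e
    leaving-arc X {v} {w} v∈X w∉X
      with sc X ((λ _ _ → _) , (v , v∈X) , (w , T-not⁺ w∉X))
    ... | e , e-leaves = e , leaves⁻ X e e-leaves

    closed⇒full : ∀ X {v} → v ∈ X → (∀ e → ¬ Leaves X e) → ∀ w → w ∈ X
    closed⇒full X v∈X closed w = decidable-stable (T? (X w)) λ w∉X →
      closed _ (proj₂ (leaving-arc X v∈X w∉X))

    onlyLeaving⇒unique : ∀ {X g v w} → OnlyLeaving X g → v ∈ X → w ∉ X →
      UniqueLeaving X g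
    onlyLeaving⇒unique {X} only v∈X w∉X with leaving-arc X v∈X w∉X
    ... | e , e-leaves = only , subst (Leaves X) (only e e-leaves) e-leaves

    strong-without : ∀ a → ∄ (λ X → UniqueLeaving X a) →
      StronglyConnected D (minusArc D a)
    strong-without a no-cut X (_ , (v , v∈X) , (w , w∉X))
      with any? (λ e → T? (minusArc D a e ∧ leaves D X e))
    ... | yes found = found
    ... | no  none  =
      ⊥-elim (no-cut (X , onlyLeaving⇒unique {w = w} only-a v∈X (T-not⁻ w∉X)))
      where
      only-a : OnlyLeaving X a
      only-a e e-leaves = sym (decidable-stable (a ≟ e) λ a≢e →
        none (e , from (T-∧ {minusArc D a e})
                       (fromWitnessFalse a≢e , leaves⁺ X e e-leaves)))

    Minimum : VSet D → Arc → Set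
    Minimum P g = ∀ Z → UniqueLeaving Z g → count P ≤ count Z

    minimum-exists : ∀ {g} → ∃ (λ X → UniqueLeaving X g) →
      ∃ λ P → UniqueLeaving P g × Minimum P g
    minimum-exists {g} (X , X-cut) = descend (<-wellFounded (count X)) X-cut
      where
      descend : ∀ {X} → Acc _<_ (count X) → UniqueLeaving X g →
        ∃ λ P → UniqueLeaving P g × Minimum P g
      descend {X} (acc smaller) X-cut
        with anySubset′? (λ Z≗Z′ (Z-cut , lt) → uniqueLeaving-resp Z≗Z′ Z-cut ,
                                               subst (_< count X) (count-cong Z≗Z′) lt)
                         (λ Z → uniqueLeaving? Z g ×-dec count Z <? count X)
      ... | yes (Z , Z-cut , lt) = descend (smaller lt) Z-cut
      ... | no  none             =
        X , X-cut , λ Z Z-cut → ≮⇒≥ λ lt → none (Z , Z-cut , lt)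

    minimum-⊆ : ∀ {P Z g v} → UniqueLeaving P g → Minimum P g →
      Z ⊆ P → v ∈ Z → OnlyLeaving Z g → P ⊆ Z
    minimum-⊆ {P} {Z} {g} {v} (_ , _ , hg∉P) P-min Z⊆P v∈Z Z-only w w∈P =
      decidable-stable (T? (Z w)) λ w∉Z →
        <⇒≱ (count-< Z⊆P w w∈P w∉Z)
            (P-min Z (onlyLeaving⇒unique {v = v} Z-only v∈Z (hg∉P ∘ Z⊆P (head D g))))

  module Deletion (tec : ThreeEdgeConnected D) (sc : StronglyConnected D (allA D)) where

    open StrongConnectivity sc

    NoCoveringCut : VSet D → Set
    NoCoveringCut U =
      ∀ f Y → OnlyLeaving Y f → Enters U f → head D f ∉ Y → ¬ (∀ w → w ∈ U ∪ Y)

    noCoveringCut-∅ : NoCoveringCut ∅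
    noCoveringCut-∅ _ _ _ (hf∈∅ , _) _ _ = ∉∅ hf∈∅

    noCoveringCut-∪ : ∀ {U P h} → NoCoveringCut U → UniqueLeaving P h → Minimum P h →
      (∀ v → v ∈ U → v ∉ P) → (∀ e → Leaves U e → head D e ∉ P) → NoCoveringCut (U ∪ P)
    noCoveringCut-∪ {U} {P} {h} U-nc P-cut P-min U∩P≡∅ U↛P
                    f Y Y-only (hf∈U∪P , tf∉U∪P) hf∉Y covered
      with any? (λ v → T? (P v) ×-dec ¬? (T? (Y v)))
    ... | no  P⊈Y = U-nc f Y Y-only (hf∈U , tf∉U∪P ∘ ∈-∪⁺ˡ) hf∉Y covered′
      where
      P⊆Y : P ⊆ Y
      P⊆Y v v∈P = decidable-stable (T? (Y v)) λ v∉Y → P⊈Y (v , v∈P , v∉Y)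
      hf∈U : head D f ∈ U
      hf∈U = Sum.fromInj₁ (⊥-elim ∘ hf∉Y ∘ P⊆Y _) (∈-∪⁻ hf∈U∪P)
      covered′ : ∀ w → w ∈ U ∪ Y
      covered′ w with ∈-∪⁻ (covered w)
      ... | inj₂ w∈Y = ∈-∪⁺ʳ w∈Y
      ... | inj₁ w∈U∪P = [ ∈-∪⁺ˡ , ∈-∪⁺ʳ ∘ P⊆Y w ]′ (∈-∪⁻ w∈U∪P)
    ... | yes (v , v∈P , v∉Y) =
      no-two-arc-cut tec P v∈P (tf∉U∪P ∘ ∈-∪⁺ʳ) (proj₁ P-cut) only-f-enters
      where
      P∩Y-only : OnlyLeaving (P ∩ Y) h
      P∩Y-only e e-leaves with leaves-∩ e-leaves
      ... | inj₁ leaves-P = proj₁ P-cut e leaves-P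
      ... | inj₂ leaves-Y with Y-only e leaves-Y
      ...   | refl = ⊥-elim (tf∉U∪P (∈-∪⁺ʳ (proj₁ (∈-∩⁻ (proj₁ e-leaves)))))
      Y∩P≡∅ : ∀ w → w ∈ Y → w ∉ P
      Y∩P≡∅ w w∈Y w∈P = v∉Y (proj₂ (∈-∩⁻ (P⊆P∩Y v v∈P)))
        where
        P⊆P∩Y : P ⊆ P ∩ Y
        P⊆P∩Y = minimum-⊆ P-cut P-min (λ _ → proj₁ ∘ ∈-∩⁻) (∈-∩⁺ w∈P w∈Y) P∩Y-only
      only-f-enters : OnlyEntering P f
      only-f-enters e (he∈P , te∉P) with ∈-∪⁻ (covered (tail D e))
      ... | inj₂ te∈Y = Y-only e (te∈Y , λ he∈Y → Y∩P≡∅ _ he∈Y he∈P)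
      ... | inj₁ te∈U∪P with ∈-∪⁻ te∈U∪P
      ...   | inj₁ te∈U = ⊥-elim (U↛P e (te∈U , λ he∈U → U∩P≡∅ _ he∈U he∈P) he∈P)
      ...   | inj₂ te∈P = ⊥-elim (te∉P te∈P)

    module InCircuit {V : VSet D} {A : ASet D}
      (sub : IsSubdigraph D V A) (cycle : IsCycle D V A) (scC : StronglyConnectedOn D V A)
      (min-cut : ∀ f → T (A f) → ∃ λ Y → UniqueLeaving Y f × Minimum Y f) where

      record Stage : Set where
        field
          U      : VSet D
          g      : Arc
          g∈A    : T (A g)
          U-only : OnlyLeaving U g
          tg∈U   : tail D g ∈ U
          hg∉U   : head D g ∉ U
          U-nc   : NoCoveringCut U

      module Extension (s : Stage) {f : Arc}
        (hf∈U : head D f ∈ Stage.U s) (tf∉U : tail D f ∉ Stage.U s)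
        {Y : VSet D} (Y-only : OnlyLeaving Y f) (tf∈Y : tail D f ∈ Y) (hf∉Y : head D f ∉ Y)
        (Y-min : Minimum Y f) where

        open Stage s

        U∪Y-only : OnlyLeaving (U ∪ Y) g
        U∪Y-only e e-leaves with leaves-∪ e-leaves
        ... | inj₁ leaves-U = U-only e leaves-U
        ... | inj₂ leaves-Y with Y-only e leaves-Y
        ...   | refl = ⊥-elim (proj₂ e-leaves (∈-∪⁺ˡ hf∈U))

        U∪Y-closed : tail D g ∈ Y ⊎ head D g ∈ Y → ∀ e → ¬ Leaves (U ∪ Y) e
        U∪Y-closed g-touches e e-leaves with U∪Y-only e e-leaves | g-touches
        ... | refl | inj₂ hg∈Y = proj₂ e-leaves (∈-∪⁺ʳ hg∈Y)
        ... | refl | inj₁ tg∈Y with Y-only g (tg∈Y , proj₂ e-leaves ∘ ∈-∪⁺ʳ)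
        ...   | refl = tf∉U tg∈U

        g-misses-Y : ¬ (tail D g ∈ Y ⊎ head D g ∈ Y)
        g-misses-Y g-touches =
          U-nc f Y Y-only (hf∈U , tf∉U) hf∉Y
            (closed⇒full (U ∪ Y) (∈-∪⁺ˡ tg∈U) (U∪Y-closed g-touches))

        U∩Y≡∅ : ∀ v → v ∈ U → v ∉ Y
        U∩Y≡∅ v v∈U v∈Y =
          tf∉U (proj₁ (∈-∩⁻ (closed⇒full (U ∩ Y) (∈-∩⁺ v∈U v∈Y) closed (tail D f))))
          where
          closed : ∀ e → ¬ Leaves (U ∩ Y) e
          closed e e-leaves with leaves-∩ e-leaves
          ... | inj₁ leaves-U with U-only e leaves-U
          ...   | refl = g-misses-Y (inj₁ (proj₂ (∈-∩⁻ (proj₁ e-leaves))))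
          closed e e-leaves | inj₂ leaves-Y with Y-only e leaves-Y
          ...   | refl = tf∉U (proj₁ (∈-∩⁻ (proj₁ e-leaves)))

        U↛Y : ∀ e → Leaves U e → head D e ∉ Y
        U↛Y e leaves-U rewrite U-only e leaves-U = g-misses-Y ∘ inj₂

        extended : Stage
        extended = record
          { U = U ∪ Y ; g = g ; g∈A = g∈A ; U-only = U∪Y-only ; tg∈U = ∈-∪⁺ˡ tg∈U
          ; hg∉U = [ hg∉U , g-misses-Y ∘ inj₂ ]′ ∘ ∈-∪⁻
          ; U-nc = noCoveringCut-∪ U-nc (Y-only , tf∈Y , hf∉Y) Y-min U∩Y≡∅ U↛Y }

        grows : count U < count (U ∪ Y)
        grows = count-< (λ _ → ∈-∪⁺ˡ) (tail D f) (∈-∪⁺ʳ tf∈Y) tf∉U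

      grow : ∀ s → ∃ λ s′ → count (Stage.U s) < count (Stage.U s′)
      grow s with subdigraph-ends {V} sub (Stage.g∈A s)
      ... | tg∈V , hg∈V
        with enters-separating {U = Stage.U s} sub scC hg∈V (Stage.hg∉U s) tg∈V (Stage.tg∈U s)
      ...   | f , f∈A , hf∈U , tf∉U with min-cut f f∈A
      ...     | Y , (Y-only , tf∈Y , hf∉Y) , Y-min = extended , grows
        where open Extension s hf∈U tf∉U Y-only tf∈Y hf∉Y Y-min

      start : Stage
      start with cycle-has-arc cycle
      ... | g , g∈A with min-cut g g∈A
      ...   | P , P-cut , P-min = record
        { U = ∅ ∪ P ; g = g ; g∈A = g∈A
        ; U-only = proj₁ ∅∪P-cut ; tg∈U = proj₁ (proj₂ ∅∪P-cut) ; hg∉U = proj₂ (proj₂ ∅∪P-cut)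
        ; U-nc = noCoveringCut-∪ noCoveringCut-∅ P-cut P-min
                   (λ _ → ⊥-elim ∘ ∉∅) (λ _ → ⊥-elim ∘ ∉∅ ∘ proj₁) }
        where
        ∅∪P-cut : UniqueLeaving (∅ ∪ P) g
        ∅∪P-cut = uniqueLeaving-resp (sym ∘ ∅-∪ P) P-cut

      impossible : ⊥
      impossible = no-ascending-chain (count ∘ Stage.U) (count≤ ∘ Stage.U) grow start

    deletable-arc : ∀ {V A} → IsCircuit D V A →
      ∃ λ a → T (A a) × StronglyConnected D (minusArc D a)
    deletable-arc {V} {A} (sub , cycle , scC)
      with any? (λ a → T? (A a) ×-dec ¬? (uniqueLeaving-exists? a))
    ... | yes (a , a∈A , no-cut) = a , a∈A , strong-without a no-cut
    ... | no  none               =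
      ⊥-elim (InCircuit.impossible sub cycle scC (λ f → minimum-exists ∘ cut f))
      where
      cut : ∀ f → T (A f) → ∃ λ X → UniqueLeaving X f
      cut f f∈A = decidable-stable (uniqueLeaving-exists? f) λ no-cut → none (f , f∈A , no-cut)

lemma1 : (D : Digraph) → ThreeEdgeConnected D →
    StronglyConnected D (allA D) →
    (V : VSet D) (A : ASet D) → IsCircuit D V A →
    ∃ λ a → T (A a) × StronglyConnected D (minusArc D a)
lemma1 D tec sc V A = CircuitArcs.Deletion.deletable-arc D tec sc
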